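{- Let $k$ and $d$ be integers with $1\le d\le \lfloor k/2\rfloor$. If $H$ is a directed 3-hypergraph representing $T_k$ in which the central vertex $u$ is the head of at most $d$ hyperarcs, then $H$ has at least $|E(T_k)|+k-d$ hyperarcs.
   Context: $T_k$ is the tree with a central vertex $u$ adjacent to vertices $v_1,\dots,v_k$, where each $v_i$ is adjacent to one further leaf $w_i$. A directed 3-hypergraph $H=(V,F)$ consists of hyperarcs $a,b\to c$ (body $\{a,b\}$ of two distinct vertices, head $c$). The closure $cl_H(S)$ of $S\subseteq V$ is obtained by forward chaining: mark $S$; while some hyperarc $a,b\to c$ has $a,b$ marked and $c$ unmarked, mark $c$. $H$ represents $G=(V,E)$ if for all distinct $x,y$: $(x,y)\in E\Rightarrow cl_H(\{x,y\})=V$ and $(x,y)\notin E\Rightarrow cl_H(\{x,y\})=\{x,y\}$. -}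

module Defs where

open import Data.Nat using (ℕ; _*_)
open import Data.Fin using (Fin)
open import Data.List using (List; []; _∷_)
open import Data.List.Membership.Propositional using (_∈_)
open import Data.List.Relation.Unary.AllPairs using (AllPairs)
open import Data.Product using (_×_)
open import Data.Sum using (_⊎_)
open import Data.Empty using (⊥)
open import Relation.Nullary using (¬_)
open import Relation.Binary.PropositionalEquality using (_≡_; _≢_)

-- Vertices of T_k : centre u, middle vertices v_i, leaves w_i (i < k).
data Vtx (k : ℕ) : Set where
  u : Vtx k
  v : Fin k → Vtx k
  w : Fin k → Vtx k

data Adj {k : ℕ} : Vtx k → Vtx k → Set where
  uv : (i : Fin k) → Adj u (v i)
  vu : (i : Fin k) → Adj (v i) u
  vw : (i : Fin k) → Adj (v i) (w i)
  wv : (i : Fin k) → Adj (w i) (v i)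

-- |E(T_k)| = 2k  (edges {u,v_i} and {v_i,w_i}, i = 1..k).
numEdgesT : ℕ → ℕ
numEdgesT k = 2 * k

record Hyperarc (V : Set) : Set where
  constructor arc
  field
    tail₁ tail₂ : V
    distinct : tail₁ ≢ tail₂
    head : V
open Hyperarc public

SameArc : {V : Set} → Hyperarc V → Hyperarc V → Set
SameArc e f =
  head e ≡ head f ×
  ((tail₁ e ≡ tail₁ f × tail₂ e ≡ tail₂ f) ⊎ (tail₁ e ≡ tail₂ f × tail₂ e ≡ tail₁ f))

-- A directed 3-hypergraph on V: a finite list of pairwise distinct hyperarcs
-- (so the number of hyperarcs is the length of the list).
record Hypergraph3 (V : Set) : Set where
  constructor hyp
  field
    arcs : List (Hyperarc V)
    noDup : AllPairs (λ e f → ¬ SameArc e f) arcs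
open Hypergraph3 public

data Cl2 {V : Set} (H : Hypergraph3 V) (x y : V) : V → Set where
  base₁ : Cl2 H x y x
  base₂ : Cl2 H x y y
  step  : (e : Hyperarc V) → e ∈ arcs H →
          Cl2 H x y (tail₁ e) → Cl2 H x y (tail₂ e) → Cl2 H x y (head e)

Represents : {V : Set} → Hypergraph3 V → (V → V → Set) → Set
Represents {V} H E = (x y : V) → x ≢ y →
  (E x y → (z : V) → Cl2 H x y z) ×
  (¬ E x y → (z : V) → Cl2 H x y z → z ≡ x ⊎ z ≡ y)

headsAtU : {k : ℕ} → List (Hyperarc (Vtx k)) → ℕ
headsAtU [] = 0
headsAtU (e ∷ es) with head e
... | u   = Data.Nat.suc (headsAtU es)
... | v _ = headsAtU es
... | w _ = headsAtU es

-- Charge every hyperarc whose body contains a middle vertex v_i to i, with weight 2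
-- if its head is u and 1 otherwise; the total weight is then at most |F| + d. Forward
-- chaining from {x, y} reaching z ∉ S ⊇ {x, y} must fire an arc with body in S and
-- head outside S, and if H represents G such a body is an edge of G (the closure of a
-- non-edge adds nothing). So each i receives an arc with body {u, v_i} and an arc e
-- with body {v_i, w_i}. If the head h of e is not u, it is adjacent to neither v_i
-- nor w_i, and escaping {h, v_i, w_i} gives a third arc, again with body {v_i, w_i}.
-- Hence each i receives weight at least 3, and 3k ≤ |F| + d.
module Submission where

open import Defs
open import Data.Nat using (ℕ; _+_; _∸_; _≤_)
open import Data.Nat.DivMod using (_/_)
open import Data.List using (length)

open import Data.Nat using (zero; suc; _*_; z≤n; s≤s)
open import Data.Nat.Properties
open import Data.Nat.ListAction using (sum)
open import Algebra.Properties.CommutativeMonoid.Sum +-0-commutativeMonoid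
  using (sum-syntax; ∑-distrib-+; sum-replicate-zero)
open import Algebra.Properties.CommutativeSemigroup +-commutativeSemigroup using (x∙yz≈y∙xz)
open import Data.Fin using (Fin; zero; suc)
import Data.Fin.Properties as Fin
open import Data.Maybe using (Maybe; just; nothing)
open import Data.Bool using (if_then_else_)
open import Data.List using (List; []; _∷_; map)
open import Data.List.Relation.Unary.Any using (here; there; _─_)
open import Data.List.Relation.Unary.All as All using (All; []; _∷_)
open import Data.List.Relation.Unary.AllPairs using ([]; _∷_)
open import Data.List.Relation.Unary.Unique.Propositional using (Unique)
open import Data.List.Membership.Propositional using (_∈_)
open import Data.List.Relation.Binary.Subset.Propositional using (_⊆_)
open import Data.Product using (_×_; _,_; proj₁; proj₂)
open import Data.Sum using (_⊎_; inj₁; inj₂; [_,_])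
open import Relation.Nullary using (¬_; yes; no; does; contradiction)
open import Relation.Nullary.Decidable using (dec-true)
open import Relation.Unary using (Pred; Decidable)
open import Relation.Binary using (DecidableEquality)
open import Relation.Binary.PropositionalEquality
  using (_≡_; _≢_; refl; sym; trans; cong; cong₂; subst)

module _ {a} {A : Set a} where

  sum-map-─ : (f : A → ℕ) {x : A} {xs : List A} (x∈xs : x ∈ xs) →
              sum (map f xs) ≡ f x + sum (map f (xs ─ x∈xs))
  sum-map-─ f (here refl) = refl
  sum-map-─ f {x} {y ∷ _} (there x∈xs) =
    trans (cong (f y +_) (sum-map-─ f x∈xs)) (x∙yz≈y∙xz (f y) (f x) _)

  ∈-─ : {x y : A} {xs : List A} (x∈xs : x ∈ xs) → y ∈ xs → x ≢ y → y ∈ (xs ─ x∈xs)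
  ∈-─ (here refl) (here refl)  x≢y = contradiction refl x≢y
  ∈-─ (here refl) (there y∈xs) x≢y = y∈xs
  ∈-─ (there _)   (here refl)  x≢y = here refl
  ∈-─ (there x∈xs) (there y∈xs) x≢y = there (∈-─ x∈xs y∈xs x≢y)

  sum-map-mono-⊆ : (f : A → ℕ) {xs ys : List A} → Unique xs → xs ⊆ ys →
                   sum (map f xs) ≤ sum (map f ys)
  sum-map-mono-⊆ f {[]} _ _ = z≤n
  sum-map-mono-⊆ f {x ∷ xs} {ys} (x≢xs ∷ unique) xs⊆ys =
    begin
      f x + sum (map f xs)           ≤⟨ +-monoʳ-≤ (f x) (sum-map-mono-⊆ f unique xs⊆ys─x) ⟩
      f x + sum (map f (ys ─ x∈ys))  ≡⟨ sum-map-─ f x∈ys ⟨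
      sum (map f ys)                 ∎
    where
    open ≤-Reasoning
    x∈ys : x ∈ ys
    x∈ys = xs⊆ys (here refl)
    xs⊆ys─x : xs ⊆ (ys ─ x∈ys)
    xs⊆ys─x y∈xs = ∈-─ x∈ys (xs⊆ys (there y∈xs)) (All.lookup x≢xs y∈xs)

  sum-map-mono : {f g : A → ℕ} {xs : List A} → All (λ x → f x ≤ g x) xs →
                 sum (map f xs) ≤ sum (map g xs)
  sum-map-mono []           = z≤n
  sum-map-mono (fx≤gx ∷ le) = +-mono-≤ fx≤gx (sum-map-mono le)

  ∑-sum-map-comm : {n : ℕ} (f : Fin n → A → ℕ) (xs : List A) →
                   ∑[ i < n ] sum (map (f i) xs) ≡ sum (map (λ x → ∑[ i < n ] f i x) xs)
  ∑-sum-map-comm {n} f []       = sum-replicate-zero n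
  ∑-sum-map-comm     f (x ∷ xs) =
    trans (∑-distrib-+ (λ i → f i x) _) (cong (_ +_) (∑-sum-map-comm f xs))

n*c≤∑ : {n c : ℕ} (f : Fin n → ℕ) → (∀ i → c ≤ f i) → n * c ≤ ∑[ i < n ] f i
n*c≤∑ {zero}  f c≤f = z≤n
n*c≤∑ {suc n} f c≤f = +-mono-≤ (c≤f zero) (n*c≤∑ (λ i → f (suc i)) (λ i → c≤f (suc i)))

record LeavingArc {V : Set} (H : Hypergraph3 V) (S : Pred V _) : Set where
  field
    hyperarc : Hyperarc V
    ∈arcs    : hyperarc ∈ arcs H
    tail₁∈S  : S (tail₁ hyperarc)
    tail₂∈S  : S (tail₂ hyperarc)
    head∉S   : ¬ S (head hyperarc)

data HasBody {V : Set} (a b : V) (e : Hyperarc V) : Set where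
  forward  : tail₁ e ≡ a → tail₂ e ≡ b → HasBody a b e
  backward : tail₁ e ≡ b → tail₂ e ≡ a → HasBody a b e

module _ {V : Set} where

  leavingArc : {H : Hypergraph3 V} {S : Pred V _} {x y z : V} → Decidable S →
               S x → S y → ¬ S z → Cl2 H x y z → LeavingArc H S
  leavingArc S? x∈S y∈S z∉S base₁ = contradiction x∈S z∉S
  leavingArc S? x∈S y∈S z∉S base₂ = contradiction y∈S z∉S
  leavingArc S? x∈S y∈S z∉S (step e e∈H t₁∈cl t₂∈cl) with S? (tail₁ e) | S? (tail₂ e)
  ... | no  t₁∉S | _         = leavingArc S? x∈S y∈S t₁∉S t₁∈cl
  ... | yes _    | no  t₂∉S  = leavingArc S? x∈S y∈S t₂∉S t₂∈cl
  ... | yes t₁∈S | yes t₂∈S  = record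
    { hyperarc = e ; ∈arcs = e∈H ; tail₁∈S = t₁∈S ; tail₂∈S = t₂∈S ; head∉S = z∉S }

  head∈body-of-nonedge : {H : Hypergraph3 V} {E : V → V → Set} → Represents H E →
                         {e : Hyperarc V} → e ∈ arcs H → ¬ E (tail₁ e) (tail₂ e) →
                         head e ≡ tail₁ e ⊎ head e ≡ tail₂ e
  head∈body-of-nonedge rep {e} e∈H ¬E =
    proj₂ (rep _ _ (distinct e)) ¬E (head e) (step e e∈H base₁ base₂)

  leaving-body-¬¬adjacent : {H : Hypergraph3 V} {E : V → V → Set} {S : Pred V _} →
                            Represents H E → (ℓ : LeavingArc H S) →
                            ¬ ¬ E (tail₁ (LeavingArc.hyperarc ℓ)) (tail₂ (LeavingArc.hyperarc ℓ))
  leaving-body-¬¬adjacent {S = S} rep ℓ ¬E =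
    [ (λ h≡t₁ → head∉S (subst S (sym h≡t₁) tail₁∈S))
    , (λ h≡t₂ → head∉S (subst S (sym h≡t₂) tail₂∈S))
    ] (head∈body-of-nonedge rep ∈arcs ¬E)
    where open LeavingArc ℓ

  body⊆pair : {a b : V} (e : Hyperarc V) →
              tail₁ e ∈ a ∷ b ∷ [] → tail₂ e ∈ a ∷ b ∷ [] → HasBody a b e
  body⊆pair e (here p)         (here q)         = contradiction (trans p (sym q)) (distinct e)
  body⊆pair e (here p)         (there (here q)) = forward p q
  body⊆pair e (there (here p)) (here q)         = backward p q
  body⊆pair e (there (here p)) (there (here q)) = contradiction (trans p (sym q)) (distinct e)

  HasBody-shared : {a b c d : V} {e : Hyperarc V} → HasBody a b e → HasBody c d e → a ≡ c ⊎ a ≡ d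
  HasBody-shared (forward  p _) (forward  q _) = inj₁ (trans (sym p) q)
  HasBody-shared (forward  p _) (backward q _) = inj₂ (trans (sym p) q)
  HasBody-shared (backward _ p) (forward  _ q) = inj₂ (trans (sym p) q)
  HasBody-shared (backward _ p) (backward _ q) = inj₁ (trans (sym p) q)

  adjacent-pair-avoids-isolated : {E : V → V → Set} {h a b : V} {S : List V} →
                             (∀ {x} → x ∈ S → ¬ E h x) → (∀ {x} → x ∈ S → ¬ E x h) →
                             a ∈ h ∷ S → b ∈ h ∷ S → a ≢ b → ¬ ¬ E a b → a ∈ S × b ∈ S
  adjacent-pair-avoids-isolated ¬Eh· ¬E·h (here refl) (here refl)  a≢b ¬¬E = contradiction refl a≢b
  adjacent-pair-avoids-isolated ¬Eh· ¬E·h (here refl) (there b∈S)  a≢b ¬¬E = contradiction (¬Eh· b∈S) ¬¬E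
  adjacent-pair-avoids-isolated ¬Eh· ¬E·h (there a∈S) (here refl)  a≢b ¬¬E = contradiction (¬E·h a∈S) ¬¬E
  adjacent-pair-avoids-isolated ¬Eh· ¬E·h (there a∈S) (there b∈S) a≢b ¬¬E = a∈S , b∈S

charge : {n : ℕ} → Maybe (Fin n) → ℕ → Fin n → ℕ
charge nothing  c i = 0
charge (just j) c i = if does (j Fin.≟ i) then c else 0

charge-self : {n : ℕ} (i : Fin n) (c : ℕ) → charge (just i) c i ≡ c
charge-self i c = cong (if_then c else 0) (dec-true (i Fin.≟ i) refl)

∑-charge-just : {n : ℕ} (j : Fin n) (c : ℕ) → ∑[ i < n ] charge (just j) c i ≡ c
∑-charge-just {suc n} zero    c = trans (cong (c +_) (sum-replicate-zero n)) (+-identityʳ c)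
∑-charge-just {suc n} (suc j) c = ∑-charge-just j c

∑-charge≤ : {n : ℕ} (t : Maybe (Fin n)) (c : ℕ) → ∑[ i < n ] charge t c i ≤ c
∑-charge≤ {n} nothing  c = subst (_≤ c) (sym (sum-replicate-zero n)) z≤n
∑-charge≤     (just j) c = ≤-reflexive (∑-charge-just j c)

module _ {k : ℕ} where

  _≟V_ : DecidableEquality (Vtx k)
  u   ≟V u   = yes refl
  u   ≟V v _ = no λ ()
  u   ≟V w _ = no λ ()
  v _ ≟V u   = no λ ()
  v i ≟V v j with i Fin.≟ j
  ... | yes refl = yes refl
  ... | no  i≢j  = no λ { refl → i≢j refl }
  v _ ≟V w _ = no λ ()
  w _ ≟V u   = no λ ()
  w _ ≟V v _ = no λ ()
  w i ≟V w j with i Fin.≟ j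
  ... | yes refl = yes refl
  ... | no  i≢j  = no λ { refl → i≢j refl }

  Adj-sym : {x y : Vtx k} → Adj x y → Adj y x
  Adj-sym (uv i) = vu i
  Adj-sym (vu i) = uv i
  Adj-sym (vw i) = wv i
  Adj-sym (wv i) = vw i

  ¬Adj-outside : {h x : Vtx k} {i : Fin k} → h ≢ u → h ≢ v i → h ≢ w i →
                 x ∈ v i ∷ w i ∷ [] → ¬ Adj h x
  ¬Adj-outside h≢u h≢v h≢w (here refl)         (uv _) = h≢u refl
  ¬Adj-outside h≢u h≢v h≢w (here refl)         (wv _) = h≢w refl
  ¬Adj-outside h≢u h≢v h≢w (there (here refl)) (vw _) = h≢v refl

  -- A body with two middle vertices is charged to either one; it does not matter which.
  middleIndex : Vtx k → Vtx k → Maybe (Fin k)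
  middleIndex (v i) _     = just i
  middleIndex _     (v i) = just i
  middleIndex _     _     = nothing

  middle : Hyperarc (Vtx k) → Maybe (Fin k)
  middle e = middleIndex (tail₁ e) (tail₂ e)

  middle-HasBody : {a b : Vtx k} {m : Maybe (Fin k)} {e : Hyperarc (Vtx k)} → HasBody a b e →
                   middleIndex a b ≡ m → middleIndex b a ≡ m → middle e ≡ m
  middle-HasBody (forward  p q) ab≡m ba≡m = trans (cong₂ middleIndex p q) ab≡m
  middle-HasBody (backward p q) ab≡m ba≡m = trans (cong₂ middleIndex p q) ba≡m

  cost : Hyperarc (Vtx k) → ℕ
  cost e with head e
  ... | u   = 2
  ... | v _ = 1
  ... | w _ = 1

  1≤cost : (e : Hyperarc (Vtx k)) → 1 ≤ cost e
  1≤cost e with head e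
  ... | u   = s≤s z≤n
  ... | v _ = s≤s z≤n
  ... | w _ = s≤s z≤n

  cost-head-u : (e : Hyperarc (Vtx k)) → head e ≡ u → cost e ≡ 2
  cost-head-u e h≡u rewrite h≡u = refl

  sum-cost : (es : List (Hyperarc (Vtx k))) → sum (map cost es) ≡ length es + headsAtU es
  sum-cost []       = refl
  sum-cost (e ∷ es) with head e
  ... | u   = cong suc (trans (cong suc (sum-cost es)) (sym (+-suc _ _)))
  ... | v _ = cong suc (sum-cost es)
  ... | w _ = cong suc (sum-cost es)

  weight : Fin k → Hyperarc (Vtx k) → ℕ
  weight i e = charge (middle e) (cost e) i

  weight-middle : {i : Fin k} (e : Hyperarc (Vtx k)) → middle e ≡ just i → weight i e ≡ cost e
  weight-middle {i} e m≡i = trans (cong (λ m → charge m (cost e) i) m≡i) (charge-self i (cost e))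

module _ {k : ℕ} {H : Hypergraph3 (Vtx k)} (rep : Represents H Adj) (i : Fin k) where

  open import Data.List.Membership.DecPropositional (_≟V_ {k}) using (_∈?_)

  private
    open LeavingArc

    charged-arcs-≤ : {es : List (Hyperarc (Vtx k))} → Unique es → es ⊆ arcs H →
                     All (λ e → middle e ≡ just i) es →
                     sum (map cost es) ≤ sum (map (weight i) (arcs H))
    charged-arcs-≤ unique es⊆H middles =
      ≤-trans (sum-map-mono (All.map (λ {e} m≡i → ≤-reflexive (sym (weight-middle e m≡i))) middles))
              (sum-map-mono-⊆ (weight i) unique es⊆H)

    uᵢ-reaches : (z : Vtx k) → Cl2 H u (v i) z
    uᵢ-reaches = proj₁ (rep u (v i) λ ()) (uv i)

    vᵢwᵢ-reaches : (z : Vtx k) → Cl2 H (v i) (w i) z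
    vᵢwᵢ-reaches = proj₁ (rep (v i) (w i) λ ()) (vw i)

    ℓ₁ : LeavingArc H (_∈ u ∷ v i ∷ [])
    ℓ₁ = leavingArc (λ x → x ∈? _) (here refl) (there (here refl))
                    (λ { (here ()) ; (there (here ())) }) (uᵢ-reaches (w i))

    ℓ₂ : LeavingArc H (_∈ v i ∷ w i ∷ [])
    ℓ₂ = leavingArc (λ x → x ∈? _) (here refl) (there (here refl))
                    (λ { (here ()) ; (there (here ())) }) (vᵢwᵢ-reaches u)

    e₁ e₂ : Hyperarc (Vtx k)
    e₁ = hyperarc ℓ₁
    e₂ = hyperarc ℓ₂

    body₁ : HasBody u (v i) e₁
    body₁ = body⊆pair e₁ (tail₁∈S ℓ₁) (tail₂∈S ℓ₁)

    body₂ : HasBody (v i) (w i) e₂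
    body₂ = body⊆pair e₂ (tail₁∈S ℓ₂) (tail₂∈S ℓ₂)

    middle₁ : middle e₁ ≡ just i
    middle₁ = middle-HasBody body₁ refl refl

    middle-vᵢwᵢ : {e : Hyperarc (Vtx k)} → HasBody (v i) (w i) e → middle e ≡ just i
    middle-vᵢwᵢ body = middle-HasBody body refl refl

    e₁≢ : {e : Hyperarc (Vtx k)} → HasBody (v i) (w i) e → e₁ ≢ e
    e₁≢ body refl = [ (λ ()) , (λ ()) ] (HasBody-shared body₁ body)

    gadget-weight-head-u : head e₂ ≡ u → 3 ≤ sum (map (weight i) (arcs H))
    gadget-weight-head-u h≡u =
      ≤-trans (+-mono-≤ (1≤cost e₁) (+-mono-≤ (≤-reflexive (sym (cost-head-u e₂ h≡u))) z≤n))
              (charged-arcs-≤ ((e₁≢ body₂ ∷ []) ∷ [] ∷ [])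
                              (λ { (here refl) → ∈arcs ℓ₁ ; (there (here refl)) → ∈arcs ℓ₂ })
                              (middle₁ ∷ middle-vᵢwᵢ body₂ ∷ []))

    module _ (h≢u : head e₂ ≢ u) where

      h≢v : head e₂ ≢ v i
      h≢v h≡v = head∉S ℓ₂ (here h≡v)

      h≢w : head e₂ ≢ w i
      h≢w h≡w = head∉S ℓ₂ (there (here h≡w))

      ℓ₃ : LeavingArc H (_∈ head e₂ ∷ v i ∷ w i ∷ [])
      ℓ₃ = leavingArc (λ x → x ∈? _) (there (here refl)) (there (there (here refl)))
                      (λ { (here u≡h) → h≢u (sym u≡h) ; (there (here ())) ; (there (there (here ()))) })
                      (vᵢwᵢ-reaches u)

      e₃ : Hyperarc (Vtx k)
      e₃ = hyperarc ℓ₃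

      body₃ : HasBody (v i) (w i) e₃
      body₃ = body⊆pair e₃ (proj₁ tails∈vᵢwᵢ) (proj₂ tails∈vᵢwᵢ)
        where
        tails∈vᵢwᵢ : tail₁ e₃ ∈ v i ∷ w i ∷ [] × tail₂ e₃ ∈ v i ∷ w i ∷ []
        tails∈vᵢwᵢ = adjacent-pair-avoids-isolated {E = Adj}
          (¬Adj-outside h≢u h≢v h≢w) (λ x∈ adj → ¬Adj-outside h≢u h≢v h≢w x∈ (Adj-sym adj))
          (tail₁∈S ℓ₃) (tail₂∈S ℓ₃) (distinct e₃) (leaving-body-¬¬adjacent rep ℓ₃)

      e₂≢e₃ : e₂ ≢ e₃
      e₂≢e₃ e₂≡e₃ = head∉S ℓ₃ (subst (λ e → head e ∈ _) e₂≡e₃ (here refl))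

      gadget-weight-head-not-u : 3 ≤ sum (map (weight i) (arcs H))
      gadget-weight-head-not-u =
        ≤-trans (+-mono-≤ (1≤cost e₁) (+-mono-≤ (1≤cost e₂) (+-mono-≤ (1≤cost e₃) z≤n)))
                (charged-arcs-≤ ((e₁≢ body₂ ∷ e₁≢ body₃ ∷ []) ∷ (e₂≢e₃ ∷ []) ∷ [] ∷ [])
                                (λ { (here refl) → ∈arcs ℓ₁ ; (there (here refl)) → ∈arcs ℓ₂
                                   ; (there (there (here refl))) → ∈arcs ℓ₃ })
                                (middle₁ ∷ middle-vᵢwᵢ body₂ ∷ middle-vᵢwᵢ body₃ ∷ []))

  gadget-weight : 3 ≤ sum (map (weight i) (arcs H))
  gadget-weight with head e₂ ≟V u
  ... | yes h≡u = gadget-weight-head-u h≡u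
  ... | no  h≢u = gadget-weight-head-not-u h≢u

-- The range 1 ≤ d ≤ ⌊k/2⌋ is only needed for the bound to be attained.
theorem7p5 : (k d : ℕ) → 1 ≤ d → d ≤ k / 2 →
    (H : Hypergraph3 (Vtx k)) → Represents H (Adj {k}) →
    headsAtU (arcs H) ≤ d →
    numEdgesT k + k ∸ d ≤ length (arcs H)
theorem7p5 k d _ _ H rep heads≤d = m≤n+o⇒m∸n≤o (numEdgesT k + k) d (begin
  2 * k + k                                    ≡⟨ trans (+-comm (2 * k) k) (*-comm 3 k) ⟩
  k * 3                                        ≤⟨ n*c≤∑ _ (gadget-weight rep) ⟩
  ∑[ i < k ] sum (map (weight i) F)            ≡⟨ ∑-sum-map-comm weight F ⟩
  sum (map (λ e → ∑[ i < k ] weight i e) F)    ≤⟨ sum-map-mono (All.universal (λ e → ∑-charge≤ (middle e) (cost e)) F) ⟩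
  sum (map cost F)                             ≡⟨ sum-cost F ⟩
  length F + headsAtU F                        ≤⟨ +-monoʳ-≤ (length F) heads≤d ⟩
  length F + d                                 ≡⟨ +-comm (length F) d ⟩
  d + length F                                 ∎)
  where
  open ≤-Reasoning
  F : List (Hyperarc (Vtx k))
  F = arcs H
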